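{- Let $s_1,\dots,s_m$ be a sequence of positive integers. If $s_j=1$ for some $j$ and $s_j$ is removed from the sequence, then the value of $A$ of the resulting sequence is smaller than $A(s_1,\dots,s_m)$. If any single term $s_j$ is removed from the sequence, then the value of $A$ increases by at most $1$.
   Context: For a sequence of $m$ positive integers $s_1,\dots,s_m$, define $A(s_1,\dots,s_m)=\sum_{j=1}^{m-1}|s_j-s_{j+1}-1|+|s_m-2|$; the value of $A$ on the empty sequence is $0$. -}

module Defs where

open import Data.Nat using (ℕ) renaming (_+_ to _+ℕ_)
open import Data.Integer using (ℤ; +_; _-_; ∣_∣)
open import Data.List using (List; []; _∷_)

dist1 : ℕ → ℕ → ℕ
dist1 a b = ∣ (+ a - + b) - + 1 ∣

A : List ℕ → ℕ
A [] = 0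
A (x ∷ []) = ∣ + x - + 2 ∣
A (x ∷ y ∷ xs) = dist1 x y +ℕ A (y ∷ xs)

-- A(s) is the length of the walk s₁ → s₂ → ⋯ → sₘ → 1 in which a step from a
-- to b costs |a − b − 1|, since |sₘ − 2| = |sₘ − 1 − 1|. These step costs obey
-- the triangle inequality up to an additive 1, so deleting any point of the
-- walk costs at most 1 more; and a step through the point 1 is never a
-- shortcut towards a target c ≥ 1, because the step 1 → c costs c, more than
-- the c − 1 by which detouring through 1 can help.
module Submission where

open import Defs
open import Data.Nat using (ℕ; _<_; _≤_; _+_; suc; s≤s; z≤n)
open import Data.Nat.Properties
  using (≤-refl; ≤-trans; ≤-reflexive; <-≤-trans; +-assoc; +-monoˡ-≤; +-monoʳ-≤;
         +-monoˡ-<; +-monoʳ-<; m≤m+n; m≤n+m; m<n+m; n<1+n; module ≤-Reasoning)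
open import Data.Nat.Tactic.RingSolver as ℕ-Solver using ()
open import Data.Integer as ℤ using (ℤ; +_; -_; ∣_∣)
open import Data.Integer.Properties using (∣i+j∣≤∣i∣+∣j∣; ∣-i∣≡∣i∣)
open import Data.Integer.Tactic.RingSolver using (solve-∀)
open import Data.Fin using (Fin; zero; suc)
open import Data.List using (List; length; lookup; removeAt; []; _∷_)
open import Data.List.Relation.Unary.All using (All; []; _∷_)
open import Data.Product using (_×_; _,_)
open import Relation.Binary.PropositionalEquality using (_≡_; refl; cong; sym; module ≡-Reasoning)

dist1-triangle : ∀ x y z → dist1 x z ≤ (dist1 x y + 1) + dist1 y z
dist1-triangle x y z = begin
  ∣ a ℤ.- c ℤ.- + 1 ∣                                        ≡⟨ cong ∣_∣ (split a b c) ⟩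
  ∣ (a ℤ.- b ℤ.- + 1) ℤ.+ + 1 ℤ.+ (b ℤ.- c ℤ.- + 1) ∣         ≤⟨ ∣i+j∣≤∣i∣+∣j∣ ((a ℤ.- b ℤ.- + 1) ℤ.+ + 1) (b ℤ.- c ℤ.- + 1) ⟩
  ∣ (a ℤ.- b ℤ.- + 1) ℤ.+ + 1 ∣ + dist1 y z                   ≤⟨ +-monoˡ-≤ (dist1 y z) (∣i+j∣≤∣i∣+∣j∣ (a ℤ.- b ℤ.- + 1) (+ 1)) ⟩
  (dist1 x y + 1) + dist1 y z                                 ∎
  where
  open ≤-Reasoning
  a b c : ℤ
  a = + x
  b = + y
  c = + z
  split : ∀ a b c → a ℤ.- c ℤ.- + 1 ≡ (a ℤ.- b ℤ.- + 1) ℤ.+ + 1 ℤ.+ (b ℤ.- c ℤ.- + 1)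
  split = solve-∀

dist1-one-left : ∀ c → dist1 1 c ≡ c
dist1-one-left c = begin
  ∣ + 1 ℤ.- + c ℤ.- + 1 ∣  ≡⟨ cong ∣_∣ (negate (+ c)) ⟩
  ∣ - + c ∣                ≡⟨ ∣-i∣≡∣i∣ (+ c) ⟩
  c                        ∎
  where
  open ≡-Reasoning
  negate : ∀ c → + 1 ℤ.- c ℤ.- + 1 ≡ - c
  negate = solve-∀

dist1-via-one : ∀ x {c} → 1 ≤ c → dist1 x c < dist1 x 1 + dist1 1 c
dist1-via-one x {suc c} _ rewrite dist1-one-left (suc c) = begin-strict
  ∣ + x ℤ.- + suc c ℤ.- + 1 ∣                 ≡⟨ cong ∣_∣ (split (+ x) (+ c)) ⟩
  ∣ (+ x ℤ.- + 1 ℤ.- + 1) ℤ.+ - + c ∣         ≤⟨ ∣i+j∣≤∣i∣+∣j∣ (+ x ℤ.- + 1 ℤ.- + 1) (- + c) ⟩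
  dist1 x 1 + ∣ - + c ∣                       ≡⟨ cong (_+_ (dist1 x 1)) (∣-i∣≡∣i∣ (+ c)) ⟩
  dist1 x 1 + c                               <⟨ +-monoʳ-< (dist1 x 1) (n<1+n c) ⟩
  dist1 x 1 + suc c                           ∎
  where
  open ≤-Reasoning
  split : ∀ a c → a ℤ.- (+ 1 ℤ.+ c) ℤ.- + 1 ≡ (a ℤ.- + 1 ℤ.- + 1) ℤ.+ - c
  split = solve-∀

walk : ℕ → List ℕ → ℕ
walk x []       = dist1 x 1
walk x (y ∷ ys) = dist1 x y + walk y ys

A-walk : ∀ x xs → A (x ∷ xs) ≡ walk x xs
A-walk x []       = cong ∣_∣ (twice (+ x))
  where
  twice : ∀ a → a ℤ.- + 2 ≡ a ℤ.- + 1 ℤ.- + 1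
  twice = solve-∀
A-walk x (y ∷ ys) = cong (_+_ (dist1 x y)) (A-walk y ys)

walk-start-≤ : ∀ {x y} d ys → (∀ z → dist1 x z ≤ d + dist1 y z) → walk x ys ≤ d + walk y ys
walk-start-≤ d []       first = first 1
walk-start-≤ d (z ∷ zs) first =
  ≤-trans (+-monoˡ-≤ (walk z zs) (first z)) (≤-reflexive (+-assoc d _ _))

walk-start-< : ∀ {x y} d ys → (∀ z → 1 ≤ z → dist1 x z < d + dist1 y z) →
               All (1 ≤_) ys → walk x ys < d + walk y ys
walk-start-< d []       first []        = first 1 ≤-refl
walk-start-< d (z ∷ zs) first (1≤z ∷ _) =
  <-≤-trans (+-monoˡ-< (walk z zs) (first z 1≤z)) (≤-reflexive (+-assoc d _ _))

walk-removeAt-≤ : ∀ x ys (j : Fin (length ys)) → walk x (removeAt ys j) ≤ walk x ys + 1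
walk-removeAt-≤ x (y ∷ ys) zero =
  ≤-trans (walk-start-≤ (dist1 x y + 1) ys (dist1-triangle x y))
          (≤-reflexive (rearrange (dist1 x y) (walk y ys)))
  where
  rearrange : ∀ a b → (a + 1) + b ≡ (a + b) + 1
  rearrange = ℕ-Solver.solve-∀
walk-removeAt-≤ x (y ∷ ys) (suc j) =
  ≤-trans (+-monoʳ-≤ (dist1 x y) (walk-removeAt-≤ y ys j))
          (≤-reflexive (sym (+-assoc (dist1 x y) (walk y ys) 1)))

walk-removeAt-one-< : ∀ x ys → All (1 ≤_) ys → (j : Fin (length ys)) →
                      lookup ys j ≡ 1 → walk x (removeAt ys j) < walk x ys
walk-removeAt-one-< x (.1 ∷ ys) (_ ∷ pos) zero    refl = walk-start-< (dist1 x 1) ys (λ _ → dist1-via-one x) pos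
walk-removeAt-one-< x (y ∷ ys)  (_ ∷ pos) (suc j) y≡1  = +-monoʳ-< (dist1 x y) (walk-removeAt-one-< y ys pos j y≡1)

A-tail-≤ : ∀ x xs → A xs ≤ A (x ∷ xs)
A-tail-≤ x []       = z≤n
A-tail-≤ x (y ∷ ys) = m≤n+m (A (y ∷ ys)) (dist1 x y)

A-tail-< : ∀ xs → All (1 ≤_) xs → A xs < A (1 ∷ xs)
A-tail-< []       []        = s≤s z≤n
A-tail-< (y ∷ ys) (1≤y ∷ _) rewrite dist1-one-left y = m<n+m (A (y ∷ ys)) 1≤y

A-removeAt-≤ : ∀ s (j : Fin (length s)) → A (removeAt s j) ≤ A s + 1
A-removeAt-≤ (x ∷ xs) zero = ≤-trans (A-tail-≤ x xs) (m≤m+n (A (x ∷ xs)) 1)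
A-removeAt-≤ (x ∷ xs) (suc j) rewrite A-walk x (removeAt xs j) | A-walk x xs = walk-removeAt-≤ x xs j

A-removeAt-one-< : ∀ s → All (1 ≤_) s → (j : Fin (length s)) → lookup s j ≡ 1 → A (removeAt s j) < A s
A-removeAt-one-< (.1 ∷ xs) (_ ∷ pos) zero refl = A-tail-< xs pos
A-removeAt-one-< (x ∷ xs) (_ ∷ pos) (suc j) x≡1 rewrite A-walk x (removeAt xs j) | A-walk x xs =
  walk-removeAt-one-< x xs pos j x≡1

mainTheorem7 : (s : List ℕ) → All (1 ≤_) s →
    ((j : Fin (length s)) → lookup s j ≡ 1 → A (removeAt s j) < A s)
    × ((j : Fin (length s)) → A (removeAt s j) ≤ A s + 1)
mainTheorem7 s pos = A-removeAt-one-< s pos , A-removeAt-≤ s
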